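{- Let $n \geq 2$, $m_i \geq 2$ for all $1 \leq i \leq n$, $G = K_{m_1} \square \cdots \square K_{m_n}$, and $C \subseteq V(G)$. Suppose that for every vertex $u \in V(G)$ we have $|J_C(u)| \geq 3$ and there exist two distinct indices $i_1, i_2 \in \{1,\dots,n\}$ and integers $1 \leq j_1 \leq m_{i_1}-1$, $1 \leq j_2 \leq m_{i_2}-1$ such that $\{u + e_{i_1}^{j_1}, u + e_{i_2}^{j_2}\} \subseteq C$. Then $C$ is an identifying code in $G$.
   Context: $G$ is the Hamming graph with vertex set $\mathbb{Z}_{m_1} \times \cdots \times \mathbb{Z}_{m_n}$ (componentwise modular addition), two vertices adjacent iff they differ in exactly one coordinate. $e_i^j$ denotes the vector with $j$ in the $i$-th coordinate and $0$ elsewhere. For $C \subseteq V(G)$, $J_C(v) = N[v] \cap C$ with $N[v]$ the closed neighborhood. $C$ is an identifying code if the sets $J_C(v)$, $v \in V(G)$, are all nonempty and pairwise distinct. -}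

module Defs where

open import Data.Nat using (ℕ; zero; suc; _+_; _%_; _≤_; _<_)
open import Data.Nat.DivMod using (m%n<n)
open import Data.Fin using (Fin; toℕ; fromℕ<)
open import Data.Fin.Properties using (_≟_)
open import Data.Product using (Σ; ∃; ∃-syntax; _×_; _,_)
open import Data.Sum using (_⊎_)
open import Relation.Binary.PropositionalEquality using (_≡_; _≢_)
open import Relation.Nullary using (¬_; yes; no)

-- Vertices of the Hamming graph K_{m_1} □ ... □ K_{m_n}:
-- elements of Z_{m_1} × ... × Z_{m_n}, represented as dependent functions.
Vertex : (n : ℕ) → (Fin n → ℕ) → Set
Vertex n m = (i : Fin n) → Fin (m i)

_≈V_ : ∀ {n m} → Vertex n m → Vertex n m → Set
_≈V_ {n} u v = ∀ (i : Fin n) → u i ≡ v i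

Adjacent : ∀ {n m} → Vertex n m → Vertex n m → Set
Adjacent {n} u v = ∃[ i ] (u i ≢ v i × (∀ (k : Fin n) → k ≢ i → u k ≡ v k))

InClosedNbhd : ∀ {n m} → Vertex n m → Vertex n m → Set
InClosedNbhd v w = w ≈V v ⊎ Adjacent v w

Code : (n : ℕ) → (Fin n → ℕ) → Set₁
Code n m = Vertex n m → Set

InJ : ∀ {n m} → Code n m → Vertex n m → Vertex n m → Set
InJ C v w = InClosedNbhd v w × C w

IsIdentifyingCode : ∀ {n m} → Code n m → Set
IsIdentifyingCode {n} {m} C =
  (∀ (v : Vertex n m) → ∃[ w ] InJ C v w) ×
  (∀ (u v : Vertex n m) → ¬ (u ≈V v) →
     ¬ (∀ (w : Vertex n m) → (InJ C u w → InJ C v w) × (InJ C v w → InJ C u w)))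

AtLeast3InJ : ∀ {n m} → Code n m → Vertex n m → Set
AtLeast3InJ {n} {m} C v =
  ∃[ a ] ∃[ b ] ∃[ c ]
    (InJ C v a × InJ C v b × InJ C v c ×
     ¬ (a ≈V b) × ¬ (a ≈V c) × ¬ (b ≈V c))

addMod : ∀ {k : ℕ} → Fin k → ℕ → Fin k
addMod {suc k} x j = fromℕ< (m%n<n (toℕ x + j) (suc k))

addE : ∀ {n m} → Vertex n m → (i : Fin n) → ℕ → Vertex n m
addE u i j k with k ≟ i
... | yes _ = addMod (u k) j
... | no _ = u k

-- Suppose J_C(u) = J_C(v) with u ≠ v, say u and v differ in coordinate i. Among the two code
-- neighbours u + e_{i₁}^{j₁}, u + e_{i₂}^{j₂} one, w, changes a coordinate k ≠ i. As w ∈ J_C(v)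
-- and w agrees with u at i, w is v's neighbour across coordinate i, so u and v differ in both i
-- and k. Every vertex adjacent or equal to both u and v then agrees with u off one of i, k and
-- with v at that coordinate, which leaves only two candidates; hence |J_C(u)| ≤ 2, contradicting
-- |J_C(u)| ≥ 3. Nonemptiness of the J_C(u) is immediate from |J_C(u)| ≥ 3.
module Submission where

open import Defs
open import Data.Nat using (ℕ; suc; _+_; _*_; _≤_; _∸_; s≤s; _/_; _%_; >-nonZero)
open import Data.Nat.Properties using (+-cancelˡ-≡)
open import Data.Nat.DivMod using (m≡m%n+[m/n]*n; m%n<n)
open import Data.Nat.Divisibility using (divides; >⇒∤)
open import Data.Fin using (Fin; toℕ)
open import Data.Fin.Properties using (toℕ-fromℕ<; _≟_; ¬∀⟶∃¬)
open import Data.Product using (∃-syntax; _×_; _,_; proj₁; proj₂)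
open import Data.Sum using (_⊎_; inj₁; inj₂)
open import Relation.Binary.PropositionalEquality
  using (_≡_; _≢_; refl; sym; trans; cong; ≢-sym; module ≡-Reasoning)
open import Relation.Nullary using (¬_; yes; no)
open import Data.Empty using (⊥; ⊥-elim)

addMod-≢ : ∀ {s} (x : Fin s) {j} → 1 ≤ j → j ≤ s ∸ 1 → addMod x j ≢ x
addMod-≢ {suc s} x {j} 1≤j j≤s addMod≡x =
  >⇒∤ {{>-nonZero 1≤j}} (s≤s j≤s) (divides q j≡q*N)
  where
  open ≡-Reasoning
  q : ℕ
  q = (toℕ x + j) / suc s
  [x+j]%N≡x : (toℕ x + j) % suc s ≡ toℕ x
  [x+j]%N≡x = trans (sym (toℕ-fromℕ< (m%n<n (toℕ x + j) (suc s)))) (cong toℕ addMod≡x)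
  j≡q*N : j ≡ q * suc s
  j≡q*N = +-cancelˡ-≡ (toℕ x) j (q * suc s) (begin
    toℕ x + j                        ≡⟨ m≡m%n+[m/n]*n (toℕ x + j) (suc s) ⟩
    (toℕ x + j) % suc s + q * suc s  ≡⟨ cong (_+ q * suc s) [x+j]%N≡x ⟩
    toℕ x + q * suc s                ∎)

module _ {n : ℕ} {m : Fin n → ℕ} where

  AgreesOff : Vertex n m → Vertex n m → Fin n → Set
  AgreesOff u x a = ∀ c → c ≢ a → u c ≡ x c

  ReplacedAt : Vertex n m → Vertex n m → Fin n → Vertex n m → Set
  ReplacedAt u v i x = v i ≡ x i × AgreesOff u x i

  replacedAt-unique : ∀ {u v i x y} → ReplacedAt u v i x → ReplacedAt u v i y → x ≈V y
  replacedAt-unique {i = i} (vi≡xi , u≈x) (vi≡yi , u≈y) c with c ≟ i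
  ... | yes refl = trans (sym vi≡xi) vi≡yi
  ... | no c≢i = trans (sym (u≈x c c≢i)) (u≈y c c≢i)

  closedNbhd⇒agreesOff : ∀ {u x} → Fin n → InClosedNbhd u x → ∃[ a ] AgreesOff u x a
  closedNbhd⇒agreesOff a (inj₁ x≈u) = a , λ c _ → sym (x≈u c)
  closedNbhd⇒agreesOff _ (inj₂ (a , _ , u≈x)) = a , u≈x

  addE-same : ∀ (u : Vertex n m) k j → addE u k j k ≡ addMod (u k) j
  addE-same u k j with k ≟ k
  ... | yes _ = refl
  ... | no k≢k = ⊥-elim (k≢k refl)

  addE-other : ∀ (u : Vertex n m) k j → AgreesOff u (addE u k j) k
  addE-other u k j c c≢k with c ≟ k
  ... | yes c≡k = ⊥-elim (c≢k c≡k)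
  ... | no _ = refl

  addE-changes : ∀ (u : Vertex n m) k {j} → 1 ≤ j → j ≤ m k ∸ 1 → u k ≢ addE u k j k
  addE-changes u k 1≤j j≤m uk≡ = addMod-≢ (u k) 1≤j j≤m (trans (sym (addE-same u k _)) (sym uk≡))

  agreesOff-separating : ∀ {u v x a b c} → AgreesOff u x a → AgreesOff v x b → u c ≢ v c →
    c ≡ a ⊎ c ≡ b
  agreesOff-separating {a = a} {b} {c} u≈x v≈x uc≢vc with c ≟ a | c ≟ b
  ... | yes c≡a | _ = inj₁ c≡a
  ... | no _ | yes c≡b = inj₂ c≡b
  ... | no c≢a | no c≢b = ⊥-elim (uc≢vc (trans (u≈x c c≢a) (sym (v≈x c c≢b))))

  commonNbhd-replacedAt : ∀ {u v x a b i k} → AgreesOff u x a → AgreesOff v x b →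
    u i ≢ v i → u k ≢ v k → i ≢ k → ReplacedAt u v i x ⊎ ReplacedAt u v k x
  commonNbhd-replacedAt {i = i} {k} u≈x v≈x ui≢vi uk≢vk i≢k
    with agreesOff-separating u≈x v≈x ui≢vi | agreesOff-separating u≈x v≈x uk≢vk
  ... | inj₁ refl | inj₁ refl = ⊥-elim (i≢k refl)
  ... | inj₁ refl | inj₂ refl = inj₁ (v≈x i i≢k , u≈x)
  ... | inj₂ refl | inj₁ refl = inj₂ (v≈x k (≢-sym i≢k) , u≈x)
  ... | inj₂ refl | inj₂ refl = ⊥-elim (i≢k refl)

  ¬three-in-two-singletons : ∀ {P Q : Vertex n m → Set} →
    (∀ {x y} → P x → P y → x ≈V y) → (∀ {x y} → Q x → Q y → x ≈V y) →
    ∀ {x y z} → P x ⊎ Q x → P y ⊎ Q y → P z ⊎ Q z →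
    ¬ (x ≈V y) → ¬ (x ≈V z) → ¬ (y ≈V z) → ⊥
  ¬three-in-two-singletons P! Q! (inj₁ Px) (inj₁ Py) _ x≉y _ _ = x≉y (P! Px Py)
  ¬three-in-two-singletons P! Q! (inj₂ Qx) (inj₂ Qy) _ x≉y _ _ = x≉y (Q! Qx Qy)
  ¬three-in-two-singletons P! Q! (inj₁ Px) _ (inj₁ Pz) _ x≉z _ = x≉z (P! Px Pz)
  ¬three-in-two-singletons P! Q! (inj₂ Qx) _ (inj₂ Qz) _ x≉z _ = x≉z (Q! Qx Qz)
  ¬three-in-two-singletons P! Q! _ (inj₁ Py) (inj₁ Pz) _ _ y≉z = y≉z (P! Py Pz)
  ¬three-in-two-singletons P! Q! _ (inj₂ Qy) (inj₂ Qz) _ _ y≉z = y≉z (Q! Qy Qz)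

  SameJ : Code n m → Vertex n m → Vertex n m → Set
  SameJ C u v = ∀ w → (InJ C u w → InJ C v w) × (InJ C v w → InJ C u w)

  sameJ-differAt-two : ∀ {C u v w i k} → SameJ C u v → u i ≢ v i → i ≢ k →
    AgreesOff u w k → u k ≢ w k → C w → u k ≢ v k
  sameJ-differAt-two {w = w} {i} {k} J≡ ui≢vi i≢k u≈w uk≢wk Cw uk≡vk
    with proj₁ (J≡ w) (inj₂ (k , uk≢wk , u≈w) , Cw)
  ... | w∈N[v] , _ with closedNbhd⇒agreesOff i w∈N[v]
  ... | b , v≈w with agreesOff-separating u≈w v≈w ui≢vi
  ...   | inj₁ i≡k = i≢k i≡k
  ...   | inj₂ refl = uk≢wk (trans uk≡vk (v≈w k (≢-sym i≢k)))

  sameJ-¬atLeast3 : ∀ {C u v w i k} → SameJ C u v → u i ≢ v i → i ≢ k →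
    AgreesOff u w k → u k ≢ w k → C w → ¬ AtLeast3InJ C u
  sameJ-¬atLeast3 {C} {u} {v} {i = i} {k} J≡ ui≢vi i≢k u≈w uk≢wk Cw
    (x , y , z , x∈J , y∈J , z∈J , x≉y , x≉z , y≉z) =
    ¬three-in-two-singletons (replacedAt-unique {u} {v} {i}) (replacedAt-unique {u} {v} {k})
      (classify x∈J) (classify y∈J) (classify z∈J) x≉y x≉z y≉z
    where
    uk≢vk : u k ≢ v k
    uk≢vk = sameJ-differAt-two J≡ ui≢vi i≢k u≈w uk≢wk Cw
    classify : ∀ {x} → InJ C u x → ReplacedAt u v i x ⊎ ReplacedAt u v k x
    classify {x} x∈J =
      commonNbhd-replacedAt (proj₂ (closedNbhd⇒agreesOff i (proj₁ x∈J)))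
        (proj₂ (closedNbhd⇒agreesOff i (proj₁ (proj₁ (J≡ x) x∈J)))) ui≢vi uk≢vk i≢k

proposition3p3 : (n : ℕ) → (m : Fin n → ℕ) → 2 ≤ n → (∀ i → 2 ≤ m i) →
    (C : Code n m) →
    (∀ (u : Vertex n m) →
      AtLeast3InJ C u ×
      (∃[ i₁ ] ∃[ i₂ ] ∃[ j₁ ] ∃[ j₂ ]
        (i₁ ≢ i₂ × 1 ≤ j₁ × j₁ ≤ m i₁ ∸ 1 × 1 ≤ j₂ × j₂ ≤ m i₂ ∸ 1 ×
         C (addE u i₁ j₁) × C (addE u i₂ j₂)))) →
    IsIdentifyingCode C
proposition3p3 n m _ _ C H = nonempty , separating
  where
  nonempty : ∀ v → ∃[ w ] InJ C v w
  nonempty v with proj₁ (H v)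
  ... | x , _ , _ , x∈J , _ = x , x∈J
  separating : ∀ u v → ¬ (u ≈V v) → ¬ SameJ C u v
  separating u v u≉v J≡ with ¬∀⟶∃¬ n (λ i → u i ≡ v i) (λ i → u i ≟ v i) u≉v | proj₂ (H u)
  ... | i , ui≢vi | i₁ , i₂ , j₁ , j₂ , i₁≢i₂ , 1≤j₁ , j₁≤ , 1≤j₂ , j₂≤ , Cw₁ , Cw₂ with i ≟ i₁
  ... | yes refl = sameJ-¬atLeast3 J≡ ui≢vi i₁≢i₂ (addE-other u i₂ j₂)
                     (addE-changes u i₂ 1≤j₂ j₂≤) Cw₂ (proj₁ (H u))
  ... | no i≢i₁ = sameJ-¬atLeast3 J≡ ui≢vi i≢i₁ (addE-other u i₁ j₁)
                     (addE-changes u i₁ 1≤j₁ j₁≤) Cw₁ (proj₁ (H u))
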